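{- Every Blanche Descartes graph is a Zykov graph.
   Context: Zykov's construction: $Z_1$ is the graph with one vertex. Given $Z_1,\dots,Z_k$ ($k\ge 1$), the graph $Z_{k+1}$ is obtained by taking the disjoint union of $Z_1,\dots,Z_k$ and, for each $k$-tuple $(v_1,\dots,v_k)$ with $v_i\in V(Z_i)$, adding a new vertex adjacent exactly to $v_1,\dots,v_k$. A Zykov graph is any graph isomorphic to an induced subgraph of $Z_k$ for some $k\ge 1$. Blanche Descartes construction: $D_1$ is the one-vertex graph; if $D_k$ has been constructed and has $n$ vertices, $D_{k+1}$ is obtained by taking a stable set $S$ of $k(n-1)+1$ new vertices and, for each $n$-element subset $T$ of $S$, adding a new copy of $D_k$ together with a perfect matching between $T$ and the vertices of that copy (the matchings may be chosen arbitrarily). A Blanche Descartes graph is any graph isomorphic to an induced subgraph of some graph obtained after $k$ steps of this construction, for some $k\ge 1$. -}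

module Defs where

open import Data.Nat using (ℕ; zero; suc; _+_; _*_; _∸_)
open import Data.Fin using (Fin)
open import Data.Fin.Subset using (Subset; _∈_; ∣_∣)
open import Data.Product using (Σ; _×_; _,_; proj₁; Σ-syntax)
open import Data.Sum using (_⊎_; inj₁; inj₂)
open import Data.Unit using (⊤; tt)
open import Data.Empty using (⊥)
open import Data.List using (List; []; _∷_; _++_; [_])
open import Relation.Binary.PropositionalEquality using (_≡_)
open import Function.Bundles using (_↔_; Inverse)

-- A graph: a type of vertices and an adjacency relation.
-- (All graphs built below have symmetric, irreflexive adjacency.)
record Graph : Set₁ where
  field
    V : Set
    E : V → V → Set
open Graph public

record _↪_ (H G : Graph) : Set where
  field
    f      : V H → V G
    inj    : ∀ {u v} → f u ≡ f v → u ≡ v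
    adj⇒   : ∀ {u v} → E H u v → E G (f u) (f v)
    adj⇐   : ∀ {u v} → E G (f u) (f v) → E H u v
open _↪_ public

_⊕_ : Graph → Graph → Graph
G ⊕ H = record { V = V G ⊎ V H ; E = e }
  where
  e : V G ⊎ V H → V G ⊎ V H → Set
  e (inj₁ x) (inj₁ y) = E G x y
  e (inj₂ x) (inj₂ y) = E H x y
  e _ _ = ⊥

∅G : Graph
∅G = record { V = ⊥ ; E = λ _ _ → ⊥ }

Union : List Graph → Graph
Union []       = ∅G
Union (G ∷ Gs) = G ⊕ Union Gs

Tuple : List Graph → Set
Tuple []       = ⊤
Tuple (G ∷ Gs) = V G × Tuple Gs

Entry : (Gs : List Graph) → Tuple Gs → V (Union Gs) → Set
Entry []       _       ()
Entry (G ∷ Gs) (x , t) (inj₁ y) = x ≡ y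
Entry (G ∷ Gs) (x , t) (inj₂ u) = Entry Gs t u

zstep : List Graph → Graph
zstep Gs = record { V = V (Union Gs) ⊎ Tuple Gs ; E = e }
  where
  e : V (Union Gs) ⊎ Tuple Gs → V (Union Gs) ⊎ Tuple Gs → Set
  e (inj₁ x) (inj₁ y) = E (Union Gs) x y
  e (inj₁ x) (inj₂ t) = Entry Gs t x
  e (inj₂ t) (inj₁ x) = Entry Gs t x
  e (inj₂ _) (inj₂ _) = ⊥

-- Zs k = [Z_1, …, Z_k]
Zs : ℕ → List Graph
Zs zero    = []
Zs (suc k) = Zs k ++ [ zstep (Zs k) ]

-- Z k is Zykov's graph Z_k (for k ≥ 1); Z_{k+1} = zstep [Z_1,…,Z_k],
-- and Z_1 = zstep [] is the one-vertex graph.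
Z : ℕ → Graph
Z zero    = zstep []   -- unused junk value (equals Z 1)
Z (suc k) = zstep (Zs k)

Zykov : Graph → Set
Zykov H = Σ ℕ λ k → H ↪ Z (suc k)

K1 : Graph
K1 = record { V = ⊤ ; E = λ _ _ → ⊥ }

Elem : ∀ {s} → Subset s → Set
Elem {s} T = Σ (Fin s) (λ x → x ∈ T)

-- one BD step from a graph G (with n vertices) at stage k:
-- stable set S = Fin s with s = k(n-1)+1, and for each n-subset T of S a copy
-- of G joined by the perfect matching M T between V G and T.
bdstep : (G : Graph) (s n : ℕ) →
         (M : (T : Subset s) → ∣ T ∣ ≡ n → V G ↔ Elem T) → Graph
bdstep G s n M = record { V = W ; E = e }
  where
  W : Set
  W = Fin s ⊎ Σ (Subset s) (λ T → (∣ T ∣ ≡ n) × V G)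
  m : (T : Subset s) → ∣ T ∣ ≡ n → V G → Fin s
  m T p v = proj₁ (Inverse.to (M T p) v)
  e : W → W → Set
  e (inj₁ _) (inj₁ _) = ⊥
  e (inj₁ x) (inj₂ (T , p , v)) = x ≡ m T p v
  e (inj₂ (T , p , v)) (inj₁ x) = x ≡ m T p v
  e (inj₂ (T , _ , v)) (inj₂ (T' , _ , v')) = (T ≡ T') × E G v v'

data BD : ℕ → Graph → Set₁ where
  bd-base : BD 1 K1
  bd-step : ∀ {k G} → BD k G → (n : ℕ) → (Fin n ↔ V G) →
            (M : (T : Subset (k * (n ∸ 1) + 1)) → ∣ T ∣ ≡ n → V G ↔ Elem T) →
            BD (suc k) (bdstep G (k * (n ∸ 1) + 1) n M)

BlancheDescartes : Graph → Set₁
BlancheDescartes H = Σ ℕ λ k → Σ Graph λ D → BD k D × (H ↪ D)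

-- A Blanche Descartes step over a graph G ↪ Z_{a+1} embeds into Z_{m+1} for m
-- large enough.  Every subset T of the stable set S gets its own level
-- j_T = a + 2 + (binary code of T), and the copy of G attached to T is placed
-- inside the copy of Z_{a+1} in the component Z_{j_T+1} of Z_{m+1}.  A vertex x
-- of S becomes the new vertex of Z_{m+1} whose tuple, at level j_T, picks the
-- vertex of the T-copy matched to x if x ∈ T, and otherwise a vertex of the copy
-- of Z_{a+2} in Z_{j_T+1}, which lies outside the T-copy.  Distinct
-- levels are distinct components of the union, so different copies are
-- non-adjacent, and the level of the singleton {x} separates x from the rest of
-- S.  Neither |S| nor the number of vertices of G plays any role.
module Submission where

open import Defs
open import Data.Bool using (Bool; true; false)
open import Data.Empty using (⊥-elim)
open import Data.Fin using (Fin)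
open import Data.Fin.Subset using (Subset; _∈_; ∣_∣; ⁅_⁆)
open import Data.Fin.Subset.Properties using (_∈?_; x∈⁅x⁆; x∈⁅y⁆⇒x≡y)
open import Data.List using ([]; _∷_; _++_; length)
open import Data.List.Properties using (length-++)
open import Data.Nat using (ℕ; zero; suc; _+_; _∸_; _≤_; _<_; _<′_; ≤′-refl; ≤′-step; z≤n; s≤s; _≟_; _≤?_)
open import Data.Nat.Induction using (<′-rec)
open import Data.Nat.Properties
  using (≡-irrelevant; ≤-irrelevant; +-comm; +-identityʳ; +-cancelˡ-≡; m+n∸m≡n; m≤m+n; +-monoʳ-<; <⇒≤; <⇒<′; ≤⇒≤′; 1+n≢n)
open import Data.Product using (Σ; _×_; _,_; proj₁; proj₂; map₂)
open import Data.Sum using (inj₁; inj₂)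
open import Data.Sum.Properties using (inj₁-injective; inj₂-injective)
open import Data.Unit using (tt)
open import Data.Vec using ([]; _∷_; here; there)
open import Function.Bundles using (_↔_; Inverse; _⇔_; mk⇔; Equivalence)
import Function.Properties.Equivalence as ⇔
open import Relation.Binary.PropositionalEquality using (_≡_; _≢_; refl; sym; trans; cong; cong₂; subst)
open Relation.Binary.PropositionalEquality.≡-Reasoning
open import Relation.Nullary using (yes; no)
open import Relation.Nullary.Irrelevant using (Irrelevant)

open Equivalence using (to; from)

↪-refl : ∀ {G} → G ↪ G
↪-refl = record { f = λ v → v ; inj = λ eq → eq ; adj⇒ = λ e → e ; adj⇐ = λ e → e }

↪-trans : ∀ {G H K} → G ↪ H → H ↪ K → G ↪ K
↪-trans φ ψ = record
  { f    = λ v → f ψ (f φ v)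
  ; inj  = λ eq → inj φ (inj ψ eq)
  ; adj⇒ = λ e → adj⇒ ψ (adj⇒ φ e)
  ; adj⇐ = λ e → adj⇐ φ (adj⇐ ψ e)
  }

∅G-↪ : ∀ {G} → ∅G ↪ G
∅G-↪ = record { f = λ () ; inj = λ {} ; adj⇒ = λ {} ; adj⇐ = λ {} }

⊕-injˡ : ∀ {G H} → G ↪ (G ⊕ H)
⊕-injˡ = record { f = inj₁ ; inj = inj₁-injective ; adj⇒ = λ e → e ; adj⇐ = λ e → e }

⊕-injʳ : ∀ {G H} → H ↪ (G ⊕ H)
⊕-injʳ = record { f = inj₂ ; inj = inj₂-injective ; adj⇒ = λ e → e ; adj⇐ = λ e → e }

⊕-mapʳ : ∀ {G H H′} → H ↪ H′ → (G ⊕ H) ↪ (G ⊕ H′)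
⊕-mapʳ {G} {H} {H′} φ = record
  { f = g ; inj = g-inj ; adj⇒ = λ {u} {v} → g-adj⇒ {u} {v} ; adj⇐ = λ {u} {v} → g-adj⇐ {u} {v} }
  where
  g : V (G ⊕ H) → V (G ⊕ H′)
  g (inj₁ x) = inj₁ x
  g (inj₂ y) = inj₂ (f φ y)

  g-inj : ∀ {u v} → g u ≡ g v → u ≡ v
  g-inj {inj₁ _} {inj₁ _} eq = cong inj₁ (inj₁-injective eq)
  g-inj {inj₂ _} {inj₂ _} eq = cong inj₂ (inj φ (inj₂-injective eq))

  g-adj⇒ : ∀ {u v} → E (G ⊕ H) u v → E (G ⊕ H′) (g u) (g v)
  g-adj⇒ {inj₁ _} {inj₁ _} e = e
  g-adj⇒ {inj₂ _} {inj₂ _} e = adj⇒ φ e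

  g-adj⇐ : ∀ {u v} → E (G ⊕ H′) (g u) (g v) → E (G ⊕ H) u v
  g-adj⇐ {inj₁ _} {inj₁ _} e = e
  g-adj⇐ {inj₂ _} {inj₂ _} e = adj⇐ φ e

index : ∀ Gs → V (Union Gs) → ℕ
index (_ ∷ _)  (inj₁ _) = zero
index (_ ∷ Gs) (inj₂ u) = suc (index Gs u)

index-adj : ∀ Gs {u v} → E (Union Gs) u v → index Gs u ≡ index Gs v
index-adj (_ ∷ _)  {inj₁ _} {inj₁ _} _ = refl
index-adj (_ ∷ Gs) {inj₂ _} {inj₂ _} e = cong suc (index-adj Gs e)

Union-++ˡ : ∀ xs {ys} → Union xs ↪ Union (xs ++ ys)
Union-++ˡ []       = ∅G-↪
Union-++ˡ (_ ∷ xs) = ⊕-mapʳ (Union-++ˡ xs)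

Union-++ʳ : ∀ xs {ys} → Union ys ↪ Union (xs ++ ys)
Union-++ʳ []       = ↪-refl
Union-++ʳ (_ ∷ xs) = ↪-trans (Union-++ʳ xs) ⊕-injʳ

index-++ˡ : ∀ xs {ys} u → index (xs ++ ys) (f (Union-++ˡ xs) u) ≡ index xs u
index-++ˡ (_ ∷ _)  (inj₁ _) = refl
index-++ˡ (_ ∷ xs) (inj₂ u) = cong suc (index-++ˡ xs u)

index-++ʳ : ∀ xs {ys} u → index (xs ++ ys) (f (Union-++ʳ xs) u) ≡ length xs + index ys u
index-++ʳ []       u = refl
index-++ʳ (_ ∷ xs) u = cong suc (index-++ʳ xs u)

_++ᵗ_ : ∀ {xs ys} → Tuple xs → Tuple ys → Tuple (xs ++ ys)
_++ᵗ_ {[]}    _       u = u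
_++ᵗ_ {_ ∷ _} (v , t) u = v , t ++ᵗ u

Entry-++ˡ : ∀ xs {ys} (t : Tuple xs) (u : Tuple ys) w →
            Entry (xs ++ ys) (t ++ᵗ u) (f (Union-++ˡ xs) w) ⇔ Entry xs t w
Entry-++ˡ (_ ∷ _)  (_ , _) u (inj₁ _) = ⇔.refl
Entry-++ˡ (_ ∷ xs) (_ , t) u (inj₂ w) = Entry-++ˡ xs t u w

Entry-++ʳ : ∀ xs {ys} (t : Tuple xs) (u : Tuple ys) w →
            Entry (xs ++ ys) (t ++ᵗ u) (f (Union-++ʳ xs) w) ⇔ Entry ys u w
Entry-++ʳ []       _       u w = ⇔.refl
Entry-++ʳ (_ ∷ xs) (_ , t) u w = Entry-++ʳ xs t u w

length-Zs : ∀ m → length (Zs m) ≡ m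
length-Zs zero    = refl
length-Zs (suc m) = trans (length-++ (Zs m)) (trans (cong (_+ 1) (length-Zs m)) (+-comm m 1))

Z-in : ∀ {j m} → j <′ m → Z (suc j) ↪ Union (Zs m)
Z-in {j} ≤′-refl             = ↪-trans ⊕-injˡ (Union-++ʳ (Zs j))
Z-in {m = suc m} (≤′-step p) = ↪-trans (Z-in p) (Union-++ˡ (Zs m))

index-Z-in : ∀ {j m} (p : j <′ m) v → index (Zs m) (f (Z-in p) v) ≡ j
index-Z-in {j} ≤′-refl v =
  trans (index-++ʳ (Zs j) (inj₁ v)) (trans (+-identityʳ _) (length-Zs j))
index-Z-in {m = suc m} (≤′-step p) v =
  trans (index-++ˡ (Zs m) (f (Z-in p) v)) (index-Z-in p v)

Z-in-≡⇒≡ : ∀ {i j m} (p : i <′ m) (q : j <′ m) {u v} →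
           f (Z-in p) u ≡ f (Z-in q) v → i ≡ j
Z-in-≡⇒≡ p q {u} {v} eq =
  trans (sym (index-Z-in p u)) (trans (cong (index _) eq) (index-Z-in q v))

Z-in-adj⇒≡ : ∀ {i j m} (p : i <′ m) (q : j <′ m) {u v} →
             E (Union (Zs m)) (f (Z-in p) u) (f (Z-in q) v) → i ≡ j
Z-in-adj⇒≡ p q {u} {v} e =
  trans (sym (index-Z-in p u)) (trans (index-adj _ e) (index-Z-in q v))

Union↪zstep : ∀ {Gs} → Union Gs ↪ zstep Gs
Union↪zstep = record { f = inj₁ ; inj = inj₁-injective ; adj⇒ = λ e → e ; adj⇐ = λ e → e }

Z-lift : ∀ {j m} → j <′ m → Z (suc j) ↪ Z (suc m)
Z-lift p = ↪-trans (Z-in p) Union↪zstep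

Z-lift-≡⇒≡ : ∀ {i j m} (p : i <′ m) (q : j <′ m) {u v} →
             f (Z-lift p) u ≡ f (Z-lift q) v → i ≡ j
Z-lift-≡⇒≡ p q eq = Z-in-≡⇒≡ p q (inj₁-injective eq)

tuple : ∀ m → (∀ {j} → j <′ m → V (Z (suc j))) → Tuple (Zs m)
tuple zero    g = tt
tuple (suc m) g = tuple m (λ p → g (≤′-step p)) ++ᵗ (g ≤′-refl , tt)

Entry-tuple : ∀ {j m} (g : ∀ {i} → i <′ m → V (Z (suc i))) (p : j <′ m) v →
              Entry (Zs m) (tuple m g) (f (Z-in p) v) ⇔ g p ≡ v
Entry-tuple {j} g ≤′-refl v =
  Entry-++ʳ (Zs j) (tuple j (λ p → g (≤′-step p))) (g ≤′-refl , tt) (inj₁ v)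
Entry-tuple {m = suc m} g (≤′-step p) v =
  ⇔.trans (Entry-++ˡ (Zs m) (tuple m (λ q → g (≤′-step q))) (g ≤′-refl , tt) (f (Z-in p) v))
          (Entry-tuple (λ q → g (≤′-step q)) p v)

tuple-injective : ∀ {j m} (g h : ∀ {i} → i <′ m → V (Z (suc i))) →
                  tuple m g ≡ tuple m h → (p : j <′ m) → g p ≡ h p
tuple-injective {m = m} g h eq p =
  sym (to (Entry-tuple h p (g p))
          (subst (λ t → Entry (Zs m) t (f (Z-in p) (g p))) eq (from (Entry-tuple g p (g p)) refl)))

-- A tuple vertex, hence distinct from every vertex of the union inside Z_{j+1}.
apex : ∀ j → V (Z (suc j))
apex j = inj₂ (apexTuple j)
  where
  apexTuple : ∀ j → Tuple (Zs j)
  apexTuple = <′-rec (λ j → Tuple (Zs j)) (λ j rec → tuple j (λ p → inj₂ (rec p)))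

double : ℕ → ℕ
double zero    = zero
double (suc k) = suc (suc (double k))

pow2 : ℕ → ℕ
pow2 zero    = 1
pow2 (suc s) = double (pow2 s)

pushBit : Bool → ℕ → ℕ
pushBit false k = double k
pushBit true  k = suc (double k)

popBit : ℕ → Bool × ℕ
popBit zero          = false , zero
popBit (suc zero)    = true , zero
popBit (suc (suc k)) = map₂ suc (popBit k)

popBit-pushBit : ∀ b k → popBit (pushBit b k) ≡ (b , k)
popBit-pushBit false zero    = refl
popBit-pushBit true  zero    = refl
popBit-pushBit false (suc k) = cong (map₂ suc) (popBit-pushBit false k)
popBit-pushBit true  (suc k) = cong (map₂ suc) (popBit-pushBit true k)

pushBit-< : ∀ b {k l} → k < l → pushBit b k < double l
pushBit-< false {zero}  (s≤s _)   = s≤s z≤n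
pushBit-< true  {zero}  (s≤s _)   = s≤s (s≤s z≤n)
pushBit-< false {suc k} (s≤s k<l) = s≤s (s≤s (pushBit-< false k<l))
pushBit-< true  {suc k} (s≤s k<l) = s≤s (s≤s (pushBit-< true k<l))

encode : ∀ {s} → Subset s → ℕ
encode []      = zero
encode (b ∷ T) = pushBit b (encode T)

decode : ∀ s → ℕ → Subset s
decode zero    _ = []
decode (suc s) k = proj₁ (popBit k) ∷ decode s (proj₂ (popBit k))

decode-encode : ∀ {s} (T : Subset s) → decode s (encode T) ≡ T
decode-encode []      = refl
decode-encode (b ∷ T) rewrite popBit-pushBit b (encode T) = cong (b ∷_) (decode-encode T)

encode-injective : ∀ {s} {T T′ : Subset s} → encode T ≡ encode T′ → T ≡ T′
encode-injective {s} {T} {T′} eq =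
  trans (sym (decode-encode T)) (trans (cong (decode s) eq) (decode-encode T′))

encode<pow2 : ∀ {s} (T : Subset s) → encode T < pow2 s
encode<pow2 []      = s≤s z≤n
encode<pow2 (b ∷ T) = pushBit-< b (encode<pow2 T)

∈-irrelevant : ∀ {s} {x : Fin s} {T : Subset s} → Irrelevant (x ∈ T)
∈-irrelevant here      here      = refl
∈-irrelevant (there p) (there q) = cong there (∈-irrelevant p q)

from≡⇔≡to : ∀ {A X : Set} {P : X → Set} → (∀ {x} → Irrelevant (P x)) →
            (M : A ↔ Σ X P) {x : X} (px : P x) {a : A} →
            Inverse.from M (x , px) ≡ a ⇔ x ≡ proj₁ (Inverse.to M a)
from≡⇔≡to irr M {x} px {a} = mk⇔ ⇒ ⇐
  where
  ⇒ : Inverse.from M (x , px) ≡ a → x ≡ proj₁ (Inverse.to M a)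
  ⇒ refl = cong proj₁ (sym (Inverse.strictlyInverseˡ M _))
  ⇐ : x ≡ proj₁ (Inverse.to M a) → Inverse.from M (x , px) ≡ a
  ⇐ refl = trans (cong (λ q → Inverse.from M (_ , q)) (irr px (proj₂ (Inverse.to M a))))
                 (Inverse.strictlyInverseʳ M a)

module BDStep {G : Graph} {a : ℕ} (ι : G ↪ Z (suc a)) (s n : ℕ)
              (M : (T : Subset s) → ∣ T ∣ ≡ n → V G ↔ Elem T) where

  j₀ : ℕ
  j₀ = suc (suc a)

  m : ℕ
  m = j₀ + pow2 s

  match : (T : Subset s) → ∣ T ∣ ≡ n → V G → Fin s
  match T c v = proj₁ (Inverse.to (M T c) v)

  copy : ∀ {j} → j₀ ≤ j → G ↪ Z (suc j)
  copy le = ↪-trans ι (Z-lift (≤⇒≤′ (<⇒≤ le)))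

  escape : ∀ {j} → j₀ ≤ j → V (Z (suc j))
  escape le = f (Z-lift (≤⇒≤′ le)) (apex (suc a))

  escape≢copy : ∀ {j} (le : j₀ ≤ j) v → escape le ≢ f (copy le) v
  escape≢copy le v eq = 1+n≢n (Z-lift-≡⇒≡ (≤⇒≤′ le) (≤⇒≤′ (<⇒≤ le)) eq)

  -- The entry at level j of the tuple of x ∈ S, when level j codes the subset T.
  choice : Fin s → ∀ {j} → j₀ ≤ j → Subset s → V (Z (suc j))
  choice x {j} le T with x ∈? T | ∣ T ∣ ≟ n
  ... | yes x∈T | yes c = f (copy le) (Inverse.from (M T c) (x , x∈T))
  ... | yes _   | no _  = apex j
  ... | no _    | _     = escape le

  choice≡copy⇔ : ∀ x {j} (le : j₀ ≤ j) T (c : ∣ T ∣ ≡ n) v →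
                 choice x le T ≡ f (copy le) v ⇔ x ≡ match T c v
  choice≡copy⇔ x le T c v with x ∈? T | ∣ T ∣ ≟ n
  ... | yes x∈T | yes c′ rewrite ≡-irrelevant c c′ =
    ⇔.trans (mk⇔ (inj (copy le)) (cong (f (copy le))))
            (from≡⇔≡to ∈-irrelevant (M T c′) x∈T)
  ... | yes _   | no c≢n = ⊥-elim (c≢n c)
  ... | no x∉T  | _      =
    mk⇔ (λ eq → ⊥-elim (escape≢copy le v eq))
        (λ { refl → ⊥-elim (x∉T (proj₂ (Inverse.to (M T c) v))) })

  ∈⇔choice≢escape : ∀ x {j} (le : j₀ ≤ j) T → x ∈ T ⇔ choice x le T ≢ escape le
  ∈⇔choice≢escape x le T with x ∈? T | ∣ T ∣ ≟ n
  ... | yes x∈T | yes _ = mk⇔ (λ _ eq → escape≢copy le _ (sym eq)) (λ _ → x∈T)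
  ... | yes x∈T | no _  = mk⇔ (λ _ ()) (λ _ → x∈T)
  ... | no x∉T  | _     = mk⇔ (λ x∈T → ⊥-elim (x∉T x∈T)) (λ ne → ⊥-elim (ne refl))

  code : Subset s → ℕ
  code T = j₀ + encode T

  code-injective : ∀ {T T′} → code T ≡ code T′ → T ≡ T′
  code-injective eq = encode-injective (+-cancelˡ-≡ j₀ _ _ eq)

  j₀≤code : ∀ T → j₀ ≤ code T
  j₀≤code T = m≤m+n j₀ (encode T)

  code<′m : ∀ T → code T <′ m
  code<′m T = <⇒<′ (+-monoʳ-< j₀ (encode<pow2 T))

  -- Levels below j₀ and levels coding no subset are never inspected.
  coordinate : Fin s → ∀ j → V (Z (suc j))
  coordinate x j with j₀ ≤? j
  ... | yes le = choice x le (decode s (j ∸ j₀))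
  ... | no _   = apex j

  coordinate-code : ∀ x T → coordinate x (code T) ≡ choice x (j₀≤code T) T
  coordinate-code x T with j₀ ≤? code T
  ... | yes le = cong₂ (choice x) (≤-irrelevant le (j₀≤code T))
                       (trans (cong (decode s) (m+n∸m≡n j₀ (encode T))) (decode-encode T))
  ... | no j₀≰ = ⊥-elim (j₀≰ (j₀≤code T))

  stable : Fin s → Tuple (Zs m)
  stable x = tuple m (λ {j} _ → coordinate x j)

  copyEmb : Subset s → G ↪ Union (Zs m)
  copyEmb T = ↪-trans (copy (j₀≤code T)) (Z-in (code<′m T))

  stable-adj⇔ : ∀ x T (c : ∣ T ∣ ≡ n) v →
                Entry (Zs m) (stable x) (f (copyEmb T) v) ⇔ x ≡ match T c v
  stable-adj⇔ x T c v =
    ⇔.trans (Entry-tuple (λ {j} _ → coordinate x j) (code<′m T) _)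
    (⇔.trans (mk⇔ (trans (sym (coordinate-code x T))) (trans (coordinate-code x T)))
             (choice≡copy⇔ x (j₀≤code T) T c v))

  stable-injective : ∀ {x y} → stable x ≡ stable y → x ≡ y
  stable-injective {x} {y} eq = sym (x∈⁅y⁆⇒x≡y x y∈⁅x⁆)
    where
    T : Subset s
    T = ⁅ x ⁆
    choices-agree : choice y (j₀≤code T) T ≡ choice x (j₀≤code T) T
    choices-agree =
      begin
        choice y (j₀≤code T) T  ≡⟨ coordinate-code y T ⟨
        coordinate y (code T)   ≡⟨ tuple-injective (λ {j} _ → coordinate y j) (λ {j} _ → coordinate x j)
                                                   (sym eq) (code<′m T) ⟩
        coordinate x (code T)   ≡⟨ coordinate-code x T ⟩
        choice x (j₀≤code T) T  ∎
    y∈⁅x⁆ : y ∈ T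
    y∈⁅x⁆ = from (∈⇔choice≢escape y _ T)
                 (λ eq′ → to (∈⇔choice≢escape x _ T) (x∈⁅x⁆ x) (trans (sym choices-agree) eq′))

  copies-injective : ∀ {T T′ c c′ v v′} → f (copyEmb T) v ≡ f (copyEmb T′) v′ →
                     _≡_ {A = Σ (Subset s) λ T → (∣ T ∣ ≡ n) × V G} (T , c , v) (T′ , c′ , v′)
  copies-injective {T} {T′} {c} {c′} eq
    with code-injective {T} {T′} (Z-in-≡⇒≡ (code<′m T) (code<′m T′) eq)
  ... | refl with inj (copyEmb T) eq | ≡-irrelevant c c′
  ...   | refl | refl = refl

  copies-adj⇐ : ∀ {T T′ v v′} → E (Union (Zs m)) (f (copyEmb T) v) (f (copyEmb T′) v′) →
                (T ≡ T′) × E G v v′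
  copies-adj⇐ {T} {T′} e with code-injective {T} {T′} (Z-in-adj⇒≡ (code<′m T) (code<′m T′) e)
  ... | refl = refl , adj⇐ (copyEmb T) e

  D : Graph
  D = bdstep G s n M

  φ : V D → V (Z (suc m))
  φ (inj₁ x)           = inj₂ (stable x)
  φ (inj₂ (T , _ , v)) = inj₁ (f (copyEmb T) v)

  φ-injective : ∀ {u v} → φ u ≡ φ v → u ≡ v
  φ-injective {inj₁ _} {inj₁ _} eq = cong inj₁ (stable-injective (inj₂-injective eq))
  φ-injective {inj₂ (T , _ , _)} {inj₂ (T′ , _ , _)} eq =
    cong inj₂ (copies-injective {T} {T′} (inj₁-injective eq))

  φ-adj⇒ : ∀ {u v} → E D u v → E (Z (suc m)) (φ u) (φ v)
  φ-adj⇒ {inj₁ x} {inj₂ (T , c , v)} e = from (stable-adj⇔ x T c v) e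
  φ-adj⇒ {inj₂ (T , c , v)} {inj₁ x} e = from (stable-adj⇔ x T c v) e
  φ-adj⇒ {inj₂ (T , _ , _)} {inj₂ (_ , _ , _)} (refl , e) = adj⇒ (copyEmb T) e

  φ-adj⇐ : ∀ {u v} → E (Z (suc m)) (φ u) (φ v) → E D u v
  φ-adj⇐ {inj₁ x} {inj₂ (T , c , v)} e = to (stable-adj⇔ x T c v) e
  φ-adj⇐ {inj₂ (T , c , v)} {inj₁ x} e = to (stable-adj⇔ x T c v) e
  φ-adj⇐ {inj₂ (T , _ , _)} {inj₂ (T′ , _ , _)} e = copies-adj⇐ {T} {T′} e

  embedding : D ↪ Z (suc m)
  embedding = record { f = φ ; inj = φ-injective ; adj⇒ = φ-adj⇒ ; adj⇐ = φ-adj⇐ }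

Zykov-↪ : ∀ {H G} → H ↪ G → Zykov G → Zykov H
Zykov-↪ H↪G (k , G↪Z) = k , ↪-trans H↪G G↪Z

bdstep-Zykov : ∀ {G} s n (M : (T : Subset s) → ∣ T ∣ ≡ n → V G ↔ Elem T) →
               Zykov G → Zykov (bdstep G s n M)
bdstep-Zykov s n M (a , ι) = BDStep.m {a = a} ι s n M , BDStep.embedding {a = a} ι s n M

K1↪Z1 : K1 ↪ Z 1
K1↪Z1 = record { f = λ _ → inj₂ tt ; inj = λ _ → refl ; adj⇒ = λ () ; adj⇐ = λ () }

BD⇒Zykov : ∀ {k D} → BD k D → Zykov D
BD⇒Zykov bd-base            = 0 , K1↪Z1
BD⇒Zykov (bd-step bd n _ M) = bdstep-Zykov _ n M (BD⇒Zykov bd)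

lemma10 : (H : Graph) → BlancheDescartes H → Zykov H
lemma10 H (_ , D , bd , H↪D) = Zykov-↪ H↪D (BD⇒Zykov bd)
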